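{- Let $\lambda,\mu,\nu$ be polynomial dominant weights of $GL_n$ with $\mu_i\le\lambda_i$ for all $i$. For $Y\in LR(\lambda/\mu,\nu)$, let $Y^c$ be its companion tableau and let $T_{Y^c}=(t^{(i)}_j)_{1\le j\le i\le n}$ be the $t$-array with $t^{(i)}_j=\sum_{k=1}^i a_{k,j}(Y^c)$ (equivalently, $t^{(i)}_j$ is the number of entries equal to $j$ in rows $1,\dots,i$ of $Y$). Then $\psi(Y)=T_{Y^c}$ defines a bijection from $LR(\lambda/\mu,\nu)$ onto $GZ(\nu,\lambda-\mu,\mu)$.
   Context: A polynomial dominant weight of $GL_n$ is a sequence of nonnegative integers $\lambda=(\lambda_1,\dots,\lambda_n)$ with $\lambda_1\ge\dots\ge\lambda_n$; differences are componentwise. Tableaux are drawn in English convention; row $r$ of the skew shape $\lambda/\mu$ consists of the boxes in columns $\mu_r+1,\dots,\lambda_r$. A tableau on $\lambda/\mu$ (filling with positive integers) is an LR tableau if (1) it is semistandard: entries weakly increase along rows from left to right and strictly increase down columns; and (2) its reverse reading word is Yamanouchi: if $x_1\cdots x_r$ is the word obtained by reading entries left to right in each row, starting from the bottom row and going up, then for every $s$ the word $x_rx_{r-1}\cdots x_s$ contains at least as many $a$'s as $(a+1)$'s for every $a\ge1$. Its content is $\nu$ if entry $k$ appears $\nu_k$ times for each $k$. $LR(\lambda/\mu,\nu)$ is the set of LR tableaux of shape $\lambda/\mu$ with content $\nu$. For a tableau $Y$, $a_{i,j}(Y)$ is the number of entries equal to $i$ in the $j$-th row of $Y$. The companion tableau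 $Y^c$ of $Y$ is the (non-skew) tableau whose rows weakly increase and whose $j$-th row contains exactly $a_{i,j}(Y^c)=a_{j,i}(Y)$ entries equal to $i$, for $1\le i,j\le n$. A $t$-array is an integer array $T=(t^{(i)}_j)_{1\le j\le i\le n}$; its type is its $n$-th row; its weight is $(w_1,\dots,w_n)$ with $w_1=t^{(1)}_1$, $w_i=\sum_{k=1}^i t^{(i)}_k-\sum_{k=1}^{i-1}t^{(i-1)}_k$ for $i\ge2$. $T$ is a GT pattern if $t^{(i+1)}_j\ge t^{(i)}_j$ and $t^{(i)}_j\ge t^{(i+1)}_{j+1}$ for all $1\le j\le i\le n-1$. Its exponents are $\varepsilon^{(i)}_j(T)=\sum_{1\le h<j}(t^{(i+1)}_h-2t^{(i)}_h+t^{(i-1)}_h)+(t^{(i+1)}_j-t^{(i)}_j)$ for $1\le j\le i\le n-1$. For weakly decreasing $\alpha,\gamma\in\mathbb{Z}^n$ and $\beta\in\mathbb{Z}^n$, $GZ(\alpha,\beta,\gamma)$ is the set of GT patterns of type $\alpha$ and weight $\beta$ with $\varepsilon^{(i)}_j(T)\le\gamma_i-\gamma_{i+1}$ for all $1\le j\le i\le n-1$. -}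

module Defs where

open import Data.Nat as ℕ using (ℕ; zero; suc; _+_; _∸_; _≤_; _<_)
open import Data.Integer as ℤ using (ℤ; +_)
open import Data.Fin as Fin using (Fin; toℕ)
open import Data.Vec as Vec using (Vec; lookup; toList; tabulate)
open import Data.List as List using (List; []; _∷_; length; concat; concatMap; reverse; take; replicate; filter; allFin)
open import Data.List.Relation.Unary.Linked using (Linked)
open import Data.Maybe using (Maybe; just; nothing; fromMaybe)
open import Data.Product using (_×_)
open import Relation.Binary.PropositionalEquality using (_≡_)

nth : ∀ {A : Set} → List A → ℕ → Maybe A
nth [] _ = nothing
nth (x ∷ xs) zero = just x
nth (x ∷ xs) (suc k) = nth xs k

-- 1-based access to a vector of integers (0 outside the range 1..n)
_‼_ : ∀ {n} → Vec ℤ n → ℕ → ℤ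
v ‼ i = fromMaybe (+ 0) (nth (toList v) (i ∸ 1))

sumN : ℕ → (ℕ → ℕ) → ℕ
sumN zero f = 0
sumN (suc i) f = sumN i f + f (suc i)

sumZ : ℕ → (ℕ → ℤ) → ℤ
sumZ zero f = + 0
sumZ (suc i) f = sumZ i f ℤ.+ f (suc i)

Dominant : ∀ {n} → Vec ℕ n → Set
Dominant {n} v = (i j : Fin n) → i Fin.≤ j → lookup v j ≤ lookup v i

-- componentwise difference (used only when μ ≤ λ componentwise)
_-ʷ_ : ∀ {n} → Vec ℕ n → Vec ℕ n → Vec ℕ n
la -ʷ mu = Vec.zipWith _∸_ la mu

toℤs : ∀ {n} → Vec ℕ n → Vec ℤ n
toℤs = Vec.map (λ k → + k)

-- A tableau for GL_n is a vector of n rows (row 1 = top),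
-- each row a list of entries read left to right.  An entry x : Fin n
-- stands for the positive integer  val x = toℕ x + 1  (entries of a
-- tableau with content ν ∈ ℕ^n lie in {1,…,n}).

Tableau : ℕ → Set
Tableau n = Vec (List (Fin n)) n

val : ∀ {n} → Fin n → ℕ
val x = suc (toℕ x)

count : ∀ {n} → ℕ → List (Fin n) → ℕ
count v xs = length (filter (λ x → val x ℕ.≟ v) xs)

-- row j (1-based) of a tableau (empty outside 1..n)
rowN : ∀ {n} → Tableau n → ℕ → List (Fin n)
rowN Y j = fromMaybe [] (nth (toList Y) (j ∸ 1))

a : ∀ {n} → Tableau n → ℕ → ℕ → ℕ
a Y i j = count i (rowN Y j)

readingWord : ∀ {n} → Tableau n → List (Fin n)
readingWord Y = concat (reverse (toList Y))

record IsLR {n} (la mu nu : Vec ℕ n) (Y : Tableau n) : Set where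
  field
    -- row r consists of the boxes in columns μ_r+1, …, λ_r
    shape : (r : Fin n) → lookup mu r + length (lookup Y r) ≡ lookup la r
    rowWeak : (r : Fin n) → Linked Fin._≤_ (lookup Y r)
    -- entries strictly increase down columns: the entry in column c of
    -- row r is the (c - μ_r)-th element of the list of row r
    colStrict : (r r' : Fin n) (c : ℕ) (x y : Fin n) → r Fin.< r' →
                lookup mu r < c → nth (lookup Y r) (c ∸ suc (lookup mu r)) ≡ just x →
                lookup mu r' < c → nth (lookup Y r') (c ∸ suc (lookup mu r')) ≡ just y →
                x Fin.< y
    -- reverse reading word is Yamanouchi: every word x_r x_{r-1} ⋯ x_s
    -- (= prefix of the reversed reading word) has #a ≥ #(a+1) for a ≥ 1
    yamanouchi : (k a' : ℕ) → 1 ≤ a' →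
                 count (suc a') (take k (reverse (readingWord Y)))
                   ≤ count a' (take k (reverse (readingWord Y)))
    content : (k : Fin n) → count (val k) (concat (toList Y)) ≡ lookup nu k

-- companion tableau Y^c: row j has weakly increasing entries and contains
-- exactly a_{j,i}(Y) entries equal to i, i.e. a_{i,j}(Y^c) = a_{j,i}(Y)
companion : ∀ {n} → Tableau n → Tableau n
companion {n} Y = tabulate (λ j → concatMap (λ i → replicate (a Y (val j) (val i)) i) (allFin n))

-- t-arrays: T i j = t^{(i)}_j, meaningful for 1 ≤ j ≤ i ≤ n (1-based)

TArray : Set
TArray = ℕ → ℕ → ℤ

_≈[_]_ : TArray → ℕ → TArray → Set
T ≈[ n ] T' = (i j : ℕ) → 1 ≤ j → j ≤ i → i ≤ n → T i j ≡ T' i j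

weightOf : TArray → ℕ → ℤ
weightOf T zero = + 0
weightOf T (suc i) = sumZ (suc i) (T (suc i)) ℤ.- sumZ i (T i)

ε : TArray → ℕ → ℕ → ℤ
ε T i j = sumZ (j ∸ 1) (λ h → T (suc i) h ℤ.- (+ 2) ℤ.* T i h ℤ.+ T (i ∸ 1) h)
          ℤ.+ (T (suc i) j ℤ.- T i j)

record IsGT {n} (α β : Vec ℤ n) (T : TArray) : Set where
  field
    type : (j : ℕ) → 1 ≤ j → j ≤ n → T n j ≡ α ‼ j
    weight : (i : ℕ) → 1 ≤ i → i ≤ n → weightOf T i ≡ β ‼ i
    interlace₁ : (i j : ℕ) → 1 ≤ j → j ≤ i → i ≤ n ∸ 1 → T i j ℤ.≤ T (suc i) j
    interlace₂ : (i j : ℕ) → 1 ≤ j → j ≤ i → i ≤ n ∸ 1 → T (suc i) (suc j) ℤ.≤ T i j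

record IsGZ {n} (α β γ : Vec ℤ n) (T : TArray) : Set where
  field
    gt : IsGT α β T
    expBound : (i j : ℕ) → 1 ≤ j → j ≤ i → i ≤ n ∸ 1 →
               ε T i j ℤ.≤ (γ ‼ i) ℤ.- (γ ‼ suc i)

ψ : ∀ {n} → Tableau n → TArray
ψ Y i j = + sumN i (λ k → a (companion Y) k j)

-- For a tableau Y let S i v be the number of entries v in rows 1..i and
-- P k m the number of entries ≤ m in row k.  Since a_{i,j}(Y^c) = a_{j,i}(Y),
-- ψ(Y) is the array t^{(i)}_j = S i j, and each GZ condition is a tableau
-- condition in disguise: the type is the content; the weight is the row
-- lengths λ − μ (rows contain only entries ≤ their index); interlacing
-- t^{(i+1)}_{j+1} ≤ t^{(i)}_j is the Yamanouchi condition, row by row; and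
-- ε^{(i+1)}_{j+1} = P_{i+2}(j+1) − P_{i+1}(j) ≤ μ_{i+1} − μ_{i+2} is column
-- strictness between consecutive rows, which propagates to any two rows.

module Submission where

open import Defs
open import Data.Empty using (⊥-elim)
open import Data.Fin as Fin using (Fin; toℕ; fromℕ<)
import Data.Fin.Properties as FinP
open import Data.Integer as ℤ using (ℤ; +_)
import Data.Integer.Properties as ℤP
open import Data.Integer.Solver using (module +-*-Solver)
open import Data.List as List using (List; []; _∷_; _++_; length; concat; map; reverse; take; replicate; filter; allFin; concatMap)
import Data.List.Properties as ListP
open import Data.List.Relation.Binary.Permutation.Propositional.Properties using (↭-length; filter-↭; ↭-reverse)
open import Data.List.Relation.Unary.All as All using (All; []; _∷_)
import Data.List.Relation.Unary.All.Properties as AllP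
open import Data.List.Relation.Unary.AllPairs using (AllPairs; []; _∷_)
import Data.List.Relation.Unary.AllPairs.Properties as AllPairsP
open import Data.List.Relation.Unary.Linked as Linked using (Linked; []; _∷_)
open import Data.List.Relation.Unary.Linked.Properties using (Linked⇒All; AllPairs⇒Linked)
open import Data.Maybe using (just; nothing; fromMaybe)
open import Data.Nat as ℕ using (ℕ; zero; suc; _+_; _∸_; _*_; _≤_; _<_; z≤n; s≤s; s≤s⁻¹; _≟_; _≤?_; _<?_)
open import Data.Nat.Properties
open import Algebra.Properties.CommutativeSemigroup +-commutativeSemigroup using (interchange)
open import Data.Product using (Σ; ∃; _×_; _,_; proj₁; proj₂)
open import Data.Sum using (inj₁; inj₂)
open import Data.Vec as Vec using (Vec; lookup; toList)
import Data.Vec.Properties as VecP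
open import Function using (_∘_)
open import Relation.Binary.Definitions using (tri<; tri≈; tri>)
open import Relation.Binary.PropositionalEquality
open import Relation.Nullary using (yes; no; ¬_; contradiction)

variable
  n : ℕ

count-accept : ∀ {v} (x : Fin n) xs → val x ≡ v → count v (x ∷ xs) ≡ suc (count v xs)
count-accept {v = v} x xs p = cong length (ListP.filter-accept (λ y → val y ≟ v) {x} {xs} p)

count-reject : ∀ {v} (x : Fin n) xs → ¬ val x ≡ v → count v (x ∷ xs) ≡ count v xs
count-reject {v = v} x xs p = cong length (ListP.filter-reject (λ y → val y ≟ v) {x} {xs} p)

count-head : (x : Fin n) (xs : List (Fin n)) → count (val x) (x ∷ xs) ≡ suc (count (val x) xs)
count-head x xs = count-accept x xs refl

count-++ : ∀ v (xs ys : List (Fin n)) → count v (xs ++ ys) ≡ count v xs + count v ys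
count-++ v xs ys = trans (cong length (ListP.filter-++ (λ x → val x ≟ v) xs ys)) (ListP.length-++ (filter (λ x → val x ≟ v) xs))

count-reverse : ∀ v (xs : List (Fin n)) → count v (reverse xs) ≡ count v xs
count-reverse v xs = ↭-length (filter-↭ (λ x → val x ≟ v) (↭-reverse xs))

count-take : ∀ v k (xs : List (Fin n)) → count v (take k xs) ≤ count v xs
count-take v k xs = subst (count v (take k xs) ≤_) splitCount (m≤m+n _ _)
  where
  splitCount : count v (take k xs) + count v (List.drop k xs) ≡ count v xs
  splitCount = trans (sym (count-++ v (take k xs) _)) (cong (count v) (ListP.take++drop≡id k xs))

count-none : ∀ v (xs : List (Fin n)) → All (λ x → ¬ val x ≡ v) xs → count v xs ≡ 0
count-none v xs ps = cong length (ListP.filter-none (λ x → val x ≟ v) ps)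

-- Entries are positive integers in {1,…,n}.
count-zero : (xs : List (Fin n)) → count 0 xs ≡ 0
count-zero xs = count-none 0 xs (All.universal (λ x ()) xs)

count-beyond : ∀ v (xs : List (Fin n)) → n < v → count v xs ≡ 0
count-beyond v xs n<v = count-none v xs (All.universal (λ x eq → <-irrefl eq (≤-<-trans (FinP.toℕ<n x) n<v)) xs)

sumN-cong : ∀ i (f g : ℕ → ℕ) → (∀ k → 1 ≤ k → k ≤ i → f k ≡ g k) → sumN i f ≡ sumN i g
sumN-cong zero f g f≗g = refl
sumN-cong (suc i) f g f≗g =
  cong₂ _+_ (sumN-cong i f g (λ k 1≤k k≤i → f≗g k 1≤k (m≤n⇒m≤1+n k≤i))) (f≗g (suc i) (s≤s z≤n) ≤-refl)

sumN-+ : ∀ i (f g : ℕ → ℕ) → sumN i (λ k → f k + g k) ≡ sumN i f + sumN i g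
sumN-+ zero f g = refl
sumN-+ (suc i) f g = trans (cong (_+ (f (suc i) + g (suc i))) (sumN-+ i f g)) (interchange (sumN i f) (sumN i g) (f (suc i)) (g (suc i)))

sumN-shift : ∀ i (f : ℕ → ℕ) → sumN (suc i) f ≡ f 1 + sumN i (λ k → f (suc k))
sumN-shift zero f = +-comm 0 (f 1)
sumN-shift (suc i) f = trans (cong (_+ f (suc (suc i))) (sumN-shift i f)) (+-assoc (f 1) _ _)

sumN-zero : ∀ i (f : ℕ → ℕ) → (∀ k → 1 ≤ k → k ≤ i → f k ≡ 0) → sumN i f ≡ 0
sumN-zero i f f≗0 = trans (sumN-cong i f (λ _ → 0) f≗0) (vanish i)
  where
  vanish : ∀ i → sumN i (λ _ → 0) ≡ 0
  vanish zero = refl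
  vanish (suc i) = trans (+-identityʳ _) (vanish i)

sumN-tail : ∀ i m (f : ℕ → ℕ) → (∀ k → i < k → f k ≡ 0) → i ≤ m → sumN m f ≡ sumN i f
sumN-tail i zero f f≗0 z≤n = refl
sumN-tail i (suc m) f f≗0 i≤1+m with m≤n⇒m<n∨m≡n i≤1+m
... | inj₂ refl = refl
... | inj₁ i<1+m = trans (cong₂ _+_ (sumN-tail i m f f≗0 (s≤s⁻¹ i<1+m)) (f≗0 (suc m) i<1+m)) (+-identityʳ _)

-- Number of entries ≤ m of a list, Σ_{v ≤ m} count v; these numbers locate
-- entries in sorted rows and the ε-exponents of ψ(Y) are their differences.
countUpTo : ℕ → List (Fin n) → ℕ
countUpTo m xs = sumN m (λ v → count v xs)

countUpTo-++ : ∀ m (xs ys : List (Fin n)) → countUpTo m (xs ++ ys) ≡ countUpTo m xs + countUpTo m ys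
countUpTo-++ m xs ys = trans (sumN-cong m _ _ (λ v _ _ → count-++ v xs ys)) (sumN-+ m _ _)

countUpTo-∷ : ∀ m (x : Fin n) xs → countUpTo m (x ∷ xs) ≡ countUpTo m (x ∷ []) + countUpTo m xs
countUpTo-∷ m x = countUpTo-++ m (x ∷ [])

countUpTo-above : ∀ m (x : Fin n) → m < val x → countUpTo m (x ∷ []) ≡ 0
countUpTo-above m x m<x = sumN-zero m _ (λ v _ v≤m → count-reject x [] (λ x≡v → <-irrefl (sym x≡v) (≤-<-trans v≤m m<x)))

countUpTo-below : ∀ m (x : Fin n) → val x ≤ m → countUpTo m (x ∷ []) ≡ 1
countUpTo-below (suc m) x x≤1+m with val x ≟ suc m
... | yes x≡1+m = cong₂ _+_ (countUpTo-above m x (≤-reflexive (sym x≡1+m))) (count-accept x [] x≡1+m)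
... | no x≢1+m = cong₂ _+_ (countUpTo-below m x (s≤s⁻¹ (≤∧≢⇒< x≤1+m x≢1+m))) (count-reject x [] x≢1+m)

countUpTo-single≤1 : ∀ m (x : Fin n) → countUpTo m (x ∷ []) ≤ 1
countUpTo-single≤1 m x with val x ≤? m
... | yes x≤m = ≤-reflexive (countUpTo-below m x x≤m)
... | no x≰m = ≤-trans (≤-reflexive (countUpTo-above m x (≰⇒> x≰m))) z≤n

countUpTo-[] : ∀ m → countUpTo {n} m [] ≡ 0
countUpTo-[] m = sumN-zero m _ (λ _ _ _ → refl)

-- Every entry is ≤ n.
countUpTo-length : (xs : List (Fin n)) → countUpTo n xs ≡ length xs
countUpTo-length {n} [] = countUpTo-[] {n} n
countUpTo-length {n} (x ∷ xs) =
  trans (countUpTo-∷ n x xs) (cong₂ _+_ (countUpTo-below n x (FinP.toℕ<n x)) (countUpTo-length xs))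

countUpTo≤length : ∀ m (xs : List (Fin n)) → countUpTo m xs ≤ length xs
countUpTo≤length {n} m [] = ≤-reflexive (countUpTo-[] {n} m)
countUpTo≤length m (x ∷ xs) =
  ≤-trans (≤-reflexive (countUpTo-∷ m x xs)) (+-mono-≤ (countUpTo-single≤1 m x) (countUpTo≤length m xs))

countUpTo-none : ∀ m (xs : List (Fin n)) → All (λ y → m < val y) xs → countUpTo m xs ≡ 0
countUpTo-none {n} m [] [] = countUpTo-[] {n} m
countUpTo-none m (x ∷ xs) (m<x ∷ m<xs) =
  trans (countUpTo-∷ m x xs) (cong₂ _+_ (countUpTo-above m x m<x) (countUpTo-none m xs m<xs))

Sorted : List (Fin n) → Set
Sorted = Linked Fin._≤_

sorted-head : ∀ {x : Fin n} {xs} → Sorted (x ∷ xs) → All (x Fin.≤_) xs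
sorted-head {xs = []} _ = []
sorted-head {xs = y ∷ xs} (x≤y ∷ sorted) = Linked⇒All FinP.≤-trans x≤y sorted

count-below-head : ∀ {x y : Fin n} {ys} → Sorted (y ∷ ys) → toℕ x < toℕ y → count (val x) (y ∷ ys) ≡ 0
count-below-head {x = x} {ys = ys} sorted x<y = count-none (val x) (_ ∷ ys) (differs x<y ∷ All.map (λ y≤z → differs (<-≤-trans x<y y≤z)) (sorted-head sorted))
  where
  differs : ∀ {z : Fin _} → toℕ x < toℕ z → ¬ val z ≡ val x
  differs x<z z≡x = <-irrefl (sym (suc-injective z≡x)) x<z

sorted-unique : (xs ys : List (Fin n)) → Sorted xs → Sorted ys → (∀ v → count v xs ≡ count v ys) → xs ≡ ys
sorted-unique [] [] _ _ _ = refl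
sorted-unique [] (y ∷ ys) _ _ same = ⊥-elim (1+n≢0 (trans (sym (count-head y ys)) (sym (same (val y)))))
sorted-unique (x ∷ xs) [] _ _ same = ⊥-elim (1+n≢0 (trans (sym (count-head x xs)) (same (val x))))
sorted-unique (x ∷ xs) (y ∷ ys) sx sy same with <-cmp (toℕ x) (toℕ y)
... | tri< x<y _ _ = ⊥-elim (1+n≢0 (trans (sym (count-head x xs)) (trans (same (val x)) (count-below-head sy x<y))))
... | tri> _ _ y<x = ⊥-elim (1+n≢0 (trans (sym (count-head y ys)) (trans (sym (same (val y))) (count-below-head sx y<x))))
... | tri≈ _ x≡y _ with FinP.toℕ-injective x≡y
... | refl = cong (x ∷_) (sorted-unique xs ys (Linked.tail sx) (Linked.tail sy) sameTail)
  where
  sameTail : ∀ v → count v xs ≡ count v ys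
  sameTail v = +-cancelˡ-≡ (count v (x ∷ [])) _ _ (trans (sym (count-++ v (x ∷ []) xs)) (trans (same v) (count-++ v (x ∷ []) ys)))

nth-All : ∀ {A : Set} {P : A → Set} {xs : List A} {k x} → All P xs → nth xs k ≡ just x → P x
nth-All {xs = _ ∷ _} {zero} (px ∷ _) refl = px
nth-All {xs = _ ∷ _} {suc k} (_ ∷ pxs) eq = nth-All pxs eq

nth-exists : ∀ {A : Set} (xs : List A) k → k < length xs → Σ A (λ x → nth xs k ≡ just x)
nth-exists (x ∷ xs) zero _ = x , refl
nth-exists (x ∷ xs) (suc k) k<len = nth-exists xs k (s≤s⁻¹ k<len)

-- These two bounds translate column
-- strictness of a tableau into inequalities between the numbers P_k(m).
index<countUpTo : ∀ m (xs : List (Fin n)) k x → Sorted xs → nth xs k ≡ just x → val x ≤ m → k < countUpTo m xs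
index<countUpTo m (y ∷ xs) zero x sorted refl x≤m
  rewrite countUpTo-∷ m y xs | countUpTo-below m y x≤m = s≤s z≤n
index<countUpTo m (y ∷ xs) (suc k) x sorted eq x≤m
  rewrite countUpTo-∷ m y xs | countUpTo-below m y (≤-trans (s≤s (nth-All (sorted-head sorted) eq)) x≤m) =
  s≤s (index<countUpTo m xs k x (Linked.tail sorted) eq x≤m)

countUpTo≤index : ∀ m (xs : List (Fin n)) k x → Sorted xs → nth xs k ≡ just x → m < val x → countUpTo m xs ≤ k
countUpTo≤index m (y ∷ xs) zero x sorted refl m<x
  rewrite countUpTo-∷ m y xs | countUpTo-above m y m<x =
  ≤-reflexive (countUpTo-none m xs (All.map (λ y≤z → ≤-trans m<x (s≤s y≤z)) (sorted-head sorted)))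
countUpTo≤index m (y ∷ xs) (suc k) x sorted eq m<x
  rewrite countUpTo-∷ m y xs =
  +-mono-≤ (countUpTo-single≤1 m y) (countUpTo≤index m xs k x (Linked.tail sorted) eq m<x)

blocks : (Fin n → ℕ) → List (Fin n)
blocks {n} m = concatMap (λ i → replicate (m i) i) (allFin n)

blocks-sorted : (m : Fin n → ℕ) → Sorted (blocks m)
blocks-sorted {n} m = AllPairs⇒Linked (AllPairsP.concat⁺ eachBlock betweenBlocks)
  where
  blockList : map (λ i → replicate (m i) i) (allFin n) ≡ List.tabulate (λ i → replicate (m i) i)
  blockList = ListP.map-tabulate (λ i → i) (λ i → replicate (m i) i)
  constant : ∀ k (i : Fin n) → AllPairs Fin._≤_ (replicate k i)
  constant zero i = []
  constant (suc k) i = AllP.replicate⁺ k FinP.≤-refl ∷ constant k i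
  eachBlock : All (AllPairs Fin._≤_) (map (λ i → replicate (m i) i) (allFin n))
  eachBlock rewrite blockList = AllP.tabulate⁺ (λ i → constant (m i) i)
  betweenBlocks : AllPairs (λ xs ys → All (λ x → All (x Fin.≤_) ys) xs) (map (λ i → replicate (m i) i) (allFin n))
  betweenBlocks rewrite blockList =
    AllPairsP.tabulate⁺-< (λ {i} {j} i<j → AllP.replicate⁺ (m i) (AllP.replicate⁺ (m j) (<⇒≤ i<j)))

count-replicate : ∀ v k (x : Fin n) → count v (replicate k x) ≡ k * count v (x ∷ [])
count-replicate v zero x = refl
count-replicate v (suc k) x = trans (count-++ v (x ∷ []) (replicate k x)) (cong (λ c → count v (x ∷ []) + c) (count-replicate v k x))

count-map-suc : ∀ v (xs : List (Fin n)) → count (suc v) (map Fin.suc xs) ≡ count v xs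
count-map-suc v [] = refl
count-map-suc v (x ∷ xs) with val x ≟ v
... | yes x≡v = trans (count-accept (Fin.suc x) _ (cong suc x≡v)) (trans (cong suc (count-map-suc v xs)) (sym (count-accept x xs x≡v)))
... | no x≢v = trans (count-reject (Fin.suc x) _ (x≢v ∘ suc-injective)) (trans (count-map-suc v xs) (sym (count-reject x xs x≢v)))

count-allFin : (x : Fin n) → count (val x) (allFin n) ≡ 1
count-allFin {suc n} x rewrite sym (ListP.map-tabulate {n = n} (λ i → i) Fin.suc) with x
... | Fin.zero = cong suc (count-none 1 (map Fin.suc (allFin n)) (AllP.map⁺ (All.universal (λ _ eq → 1+n≢0 (suc-injective eq)) _)))
... | Fin.suc x = trans (count-reject Fin.zero (map Fin.suc (allFin n)) (λ eq → 1+n≢0 (sym (suc-injective eq)))) (trans (count-map-suc (val x) (allFin n)) (count-allFin x))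

count-blocks : (m : Fin n → ℕ) (x : Fin n) → count (val x) (blocks m) ≡ m x
count-blocks {n} m x = trans (weighted (allFin n)) (trans (cong (m x *_) (count-allFin x)) (*-identityʳ (m x)))
  where
  weighted : ∀ xs → count (val x) (concatMap (λ i → replicate (m i) i) xs) ≡ m x * count (val x) xs
  weighted [] = sym (*-zeroʳ (m x))
  weighted (y ∷ xs) with val y ≟ val x
  ... | no y≢x = trans (count-++ (val x) (replicate (m y) y) _)
                   (cong₂ _+_ (trans (count-replicate (val x) (m y) y) (trans (cong (m y *_) (count-reject y [] y≢x)) (*-zeroʳ (m y))))
                              (trans (weighted xs) (cong (m x *_) (sym (count-reject y xs y≢x)))))
  ... | yes y≡x with FinP.toℕ-injective (suc-injective y≡x)
  ... | refl = trans (count-++ (val x) (replicate (m x) x) _)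
                 (trans (cong₂ _+_ (trans (count-replicate (val x) (m x) x) (cong (m x *_) (count-head x []))) (weighted xs))
                   (sym (trans (cong (m x *_) (count-head x xs)) (*-distribˡ-+ (m x) 1 _))))

take-++ˡ : ∀ {A : Set} k (xs ys : List A) → k ≤ length xs → take k (xs ++ ys) ≡ take k xs
take-++ˡ zero xs ys _ = refl
take-++ˡ (suc k) (x ∷ xs) ys k≤len = cong (x ∷_) (take-++ˡ k xs ys (s≤s⁻¹ k≤len))

take-++ʳ : ∀ {A : Set} k (xs ys : List A) → take (length xs + k) (xs ++ ys) ≡ xs ++ take k ys
take-++ʳ k [] ys = refl
take-++ʳ k (x ∷ xs) ys = cong (x ∷_) (take-++ʳ k xs ys)

take-length : ∀ {A : Set} (xs ys : List A) → take (length xs) (xs ++ ys) ≡ xs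
take-length [] ys = refl
take-length (x ∷ xs) ys = cong (x ∷_) (take-length xs ys)

rowL : List (List (Fin n)) → ℕ → List (Fin n)
rowL R k = fromMaybe [] (nth R (k ∸ 1))

upperCount : ℕ → ℕ → List (List (Fin n)) → ℕ
upperCount v i R = sumN i (λ k → count v (rowL R k))

reverseWord : List (List (Fin n)) → List (Fin n)
reverseWord R = concat (map reverse R)

upperWord : ℕ → List (List (Fin n)) → List (Fin n)
upperWord i R = reverseWord (take i R)

reverse-readingWord : ∀ {A : Set} (R : List (List A)) → reverse (concat (reverse R)) ≡ concat (map reverse R)
reverse-readingWord [] = refl
reverse-readingWord (r ∷ R) = begin
    reverse (concat (reverse (r ∷ R)))    ≡⟨ cong (reverse ∘ concat) (ListP.unfold-reverse r R) ⟩
    reverse (concat (reverse R ++ r ∷ [])) ≡⟨ cong reverse (sym (ListP.concat-++ (reverse R) (r ∷ []))) ⟩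
    reverse (concat (reverse R) ++ r ++ []) ≡⟨ cong (λ s → reverse (concat (reverse R) ++ s)) (ListP.++-identityʳ r) ⟩
    reverse (concat (reverse R) ++ r)      ≡⟨ ListP.reverse-++ (concat (reverse R)) r ⟩
    reverse r ++ reverse (concat (reverse R)) ≡⟨ cong (reverse r ++_) (reverse-readingWord R) ⟩
    concat (map reverse (r ∷ R))           ∎
  where
  open ≡-Reasoning

upperCount-∷ : ∀ v i (r : List (Fin n)) R → upperCount v (suc i) (r ∷ R) ≡ count v r + upperCount v i R
upperCount-∷ v i r R = trans (sumN-shift i _) (cong (λ c → count v r + c) (sumN-cong i _ _ (λ { (suc k) _ _ → refl })))

upperWord-count : ∀ v i (R : List (List (Fin n))) → count v (upperWord i R) ≡ upperCount v i R
upperWord-count v zero R = refl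
upperWord-count v (suc i) [] = sym (sumN-zero (suc i) _ (λ _ _ _ → refl))
upperWord-count v (suc i) (r ∷ R) = begin
    count v (reverse r ++ upperWord i R)          ≡⟨ count-++ v (reverse r) _ ⟩
    count v (reverse r) + count v (upperWord i R) ≡⟨ cong₂ _+_ (count-reverse v r) (upperWord-count v i R) ⟩
    count v r + upperCount v i R                  ≡⟨ sym (upperCount-∷ v i r R) ⟩
    upperCount v (suc i) (r ∷ R)                  ∎
  where open ≡-Reasoning

concat-count : ∀ v (R : List (List (Fin n))) → count v (concat R) ≡ upperCount v (length R) R
concat-count v [] = refl
concat-count v (r ∷ R) =
  trans (count-++ v r (concat R)) (trans (cong (λ c → count v r + c) (concat-count v R)) (sym (upperCount-∷ v (length R) r R)))

upper-prefix : (R : List (List (Fin n))) (i p : ℕ) → i < length R → p ≤ length (rowL R (suc i)) →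
  take (length (upperWord i R) + p) (reverseWord R) ≡ upperWord i R ++ take p (reverse (rowL R (suc i)))
upper-prefix (r ∷ R) zero p _ p≤len =
  take-++ˡ p (reverse r) (reverseWord R) (subst (p ≤_) (sym (ListP.length-reverse r)) p≤len)
upper-prefix (r ∷ R) (suc i) p i<len p≤len = begin
    take (length (reverse r ++ upperWord i R) + p) (reverse r ++ reverseWord R)
      ≡⟨ cong (λ l → take l (reverse r ++ reverseWord R))
              (trans (cong (_+ p) (ListP.length-++ (reverse r))) (+-assoc (length (reverse r)) _ p)) ⟩
    take (length (reverse r) + (length (upperWord i R) + p)) (reverse r ++ reverseWord R)
      ≡⟨ take-++ʳ _ (reverse r) (reverseWord R) ⟩
    reverse r ++ take (length (upperWord i R) + p) (reverseWord R)
      ≡⟨ cong (reverse r ++_) (upper-prefix R i p (s≤s⁻¹ i<len) p≤len) ⟩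
    reverse r ++ (upperWord i R ++ take p (reverse (rowL R (suc i))))
      ≡⟨ sym (ListP.++-assoc (reverse r) _ _) ⟩
    (reverse r ++ upperWord i R) ++ take p (reverse (rowL R (suc i))) ∎
  where open ≡-Reasoning

prefix-decomposition : (r : List (Fin n)) (R : List (List (Fin n))) → ∀ k →
  Σ ℕ λ i → i < length (r ∷ R) × ∃ λ p → take k (reverseWord (r ∷ R)) ≡ upperWord i (r ∷ R) ++ take p (reverse (rowL (r ∷ R) (suc i)))
prefix-decomposition r [] k = 0 , s≤s z≤n , k , cong (take k) (ListP.++-identityʳ (reverse r))
prefix-decomposition r (r′ ∷ R) k with k ≤? length (reverse r)
... | yes k≤len = 0 , s≤s z≤n , k , take-++ˡ k (reverse r) (reverseWord (r′ ∷ R)) k≤len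
... | no k>len =
  let (i , i<len , p , eq) = prefix-decomposition r′ R (k ∸ length (reverse r))
  in suc i , s≤s i<len , p , (begin
    take k (reverse r ++ reverseWord (r′ ∷ R))
      ≡⟨ cong (λ l → take l (reverse r ++ reverseWord (r′ ∷ R))) (sym (m+[n∸m]≡n (<⇒≤ (≰⇒> k>len)))) ⟩
    take (length (reverse r) + (k ∸ length (reverse r))) (reverse r ++ reverseWord (r′ ∷ R))
      ≡⟨ take-++ʳ _ (reverse r) (reverseWord (r′ ∷ R)) ⟩
    reverse r ++ take (k ∸ length (reverse r)) (reverseWord (r′ ∷ R))
      ≡⟨ cong (reverse r ++_) eq ⟩
    reverse r ++ (upperWord i (r′ ∷ R) ++ take p (reverse (rowL (r′ ∷ R) (suc i))))
      ≡⟨ sym (ListP.++-assoc (reverse r) _ _) ⟩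
    (reverse r ++ upperWord i (r′ ∷ R)) ++ take p (reverse (rowL (r′ ∷ R) (suc i))) ∎)
  where open ≡-Reasoning

smallEntries largeEntries : ℕ → List (Fin n) → List (Fin n)
smallEntries v [] = []
smallEntries v (x ∷ xs) with val x ≤? v
... | yes _ = x ∷ smallEntries v xs
... | no _ = []
largeEntries v [] = []
largeEntries v (x ∷ xs) with val x ≤? v
... | yes _ = largeEntries v xs
... | no _ = x ∷ xs

small++large : ∀ v (xs : List (Fin n)) → smallEntries v xs ++ largeEntries v xs ≡ xs
small++large v [] = refl
small++large v (x ∷ xs) with val x ≤? v
... | yes _ = cong (x ∷_) (small++large v xs)
... | no _ = refl

largeEntries-count-above : ∀ v (xs : List (Fin n)) → count (suc v) (largeEntries v xs) ≡ count (suc v) xs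
largeEntries-count-above v [] = refl
largeEntries-count-above v (x ∷ xs) with val x ≤? v
... | yes x≤v = trans (largeEntries-count-above v xs) (sym (count-reject x xs (λ x≡1+v → <-irrefl x≡1+v (s≤s x≤v))))
... | no _ = refl

largeEntries-count-at : ∀ v (xs : List (Fin n)) → Sorted xs → count v (largeEntries v xs) ≡ 0
largeEntries-count-at v [] _ = refl
largeEntries-count-at v (x ∷ xs) sorted with val x ≤? v
... | yes _ = largeEntries-count-at v xs (Linked.tail sorted)
... | no x≰v = count-none v (x ∷ xs) (differs ≤-refl ∷ All.map (λ x≤y → differs (s≤s x≤y)) (sorted-head sorted))
  where
  differs : ∀ {y : Fin n} → val x ≤ val y → ¬ val y ≡ v
  differs x≤y y≡v = x≰v (≤-trans x≤y (≤-reflexive y≡v))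

largeEntries-length : ∀ v (xs : List (Fin n)) → length (largeEntries v xs) ≤ length xs
largeEntries-length v [] = z≤n
largeEntries-length v (x ∷ xs) with val x ≤? v
... | yes _ = m≤n⇒m≤1+n (largeEntries-length v xs)
... | no _ = ≤-refl

reverse-row-split : ∀ v (xs : List (Fin n)) →
  reverse xs ≡ reverse (largeEntries v xs) ++ reverse (smallEntries v xs)
reverse-row-split v xs = trans (cong reverse (sym (small++large v xs))) (ListP.reverse-++ (smallEntries v xs) (largeEntries v xs))

-- The Yamanouchi condition for the pair of letters v, v+1 is equivalent,
-- for sorted rows, to the inequalities  #(v+1 in rows ≤ i+1) ≤ #(v in rows ≤ i).
YamanouchiFor : ℕ → List (Fin n) → Set
YamanouchiFor v w = ∀ k → count (suc v) (take k w) ≤ count v (take k w)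

upper-large-prefix : ∀ v (R : List (List (Fin n))) i → i < length R →
  let large = reverse (largeEntries v (rowL R (suc i))) in
  take (length (upperWord i R) + length large) (reverseWord R) ≡ upperWord i R ++ large
upper-large-prefix {n} v R i i<len = begin
    take (length upper + length (reverse large)) (reverseWord R)
      ≡⟨ upper-prefix R i (length (reverse large)) i<len large≤row ⟩
    upper ++ take (length (reverse large)) (reverse row)
      ≡⟨ cong (λ w → upper ++ take (length (reverse large)) w) (reverse-row-split v row) ⟩
    upper ++ take (length (reverse large)) (reverse large ++ reverse (smallEntries v row))
      ≡⟨ cong (upper ++_) (take-length (reverse large) _) ⟩
    upper ++ reverse large ∎
  where
  open ≡-Reasoning
  row large upper : List (Fin n)
  row = rowL R (suc i)
  large = largeEntries v row
  upper = upperWord i R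
  large≤row : length (reverse large) ≤ length row
  large≤row = ≤-trans (≤-reflexive (ListP.length-reverse large)) (largeEntries-length v row)

yamanouchi⇒upper-inequality : ∀ v (R : List (List (Fin n))) i → i < length R → Sorted (rowL R (suc i)) →
  YamanouchiFor v (reverseWord R) → upperCount (suc v) (suc i) R ≤ upperCount v i R
yamanouchi⇒upper-inequality {n} v R i i<len sorted yam = begin
    upperCount (suc v) i R + count (suc v) row
      ≡⟨ cong₂ _+_ (sym (upperWord-count (suc v) i R)) (sym (trans (count-reverse (suc v) large) (largeEntries-count-above v row))) ⟩
    count (suc v) upper + count (suc v) (reverse large)
      ≡⟨ sym (count-++ (suc v) upper (reverse large)) ⟩
    count (suc v) (upper ++ reverse large)
      ≤⟨ subst (λ w → count (suc v) w ≤ count v w) (upper-large-prefix v R i i<len) (yam (length upper + length (reverse large))) ⟩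
    count v (upper ++ reverse large)
      ≡⟨ count-++ v upper (reverse large) ⟩
    count v upper + count v (reverse large)
      ≡⟨ cong₂ _+_ (upperWord-count v i R) (trans (count-reverse v large) (largeEntries-count-at v row sorted)) ⟩
    upperCount v i R + 0
      ≡⟨ +-identityʳ _ ⟩
    upperCount v i R ∎
  where
  open ≤-Reasoning
  row large upper : List (Fin n)
  row = rowL R (suc i)
  large = largeEntries v row
  upper = upperWord i R

upper-inequality⇒yamanouchi : ∀ v (R : List (List (Fin n))) →
  (∀ i → i < length R → upperCount (suc v) (suc i) R ≤ upperCount v i R) → YamanouchiFor v (reverseWord R)
upper-inequality⇒yamanouchi v [] _ zero = z≤n
upper-inequality⇒yamanouchi v [] _ (suc k) = z≤n
upper-inequality⇒yamanouchi {n} v (r ∷ R) ineq k with prefix-decomposition r R k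
... | i , i<len , p , eq = begin
    count (suc v) (take k (reverseWord (r ∷ R)))
      ≡⟨ cong (count (suc v)) eq ⟩
    count (suc v) (upper ++ partial)
      ≡⟨ count-++ (suc v) upper partial ⟩
    count (suc v) upper + count (suc v) partial
      ≤⟨ +-monoʳ-≤ (count (suc v) upper) (≤-trans (count-take (suc v) p (reverse row)) (≤-reflexive (count-reverse (suc v) row))) ⟩
    count (suc v) upper + count (suc v) row
      ≡⟨ cong (_+ count (suc v) row) (upperWord-count (suc v) i (r ∷ R)) ⟩
    upperCount (suc v) (suc i) (r ∷ R)
      ≤⟨ ineq i i<len ⟩
    upperCount v i (r ∷ R)
      ≡⟨ sym (upperWord-count v i (r ∷ R)) ⟩
    count v upper
      ≤⟨ m≤m+n _ _ ⟩
    count v upper + count v partial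
      ≡⟨ sym (count-++ v upper partial) ⟩
    count v (upper ++ partial)
      ≡⟨ cong (count v) (sym eq) ⟩
    count v (take k (reverseWord (r ∷ R))) ∎
  where
  open ≤-Reasoning
  row upper partial : List (Fin n)
  row = rowL (r ∷ R) (suc i)
  upper = upperWord i (r ∷ R)
  partial = take p (reverse row)

-- A row with offset m (its boxes occupy columns m+1, m+2, …) has in column c
-- the entry of index c ∸ (m+1); the index is in range iff c ≤ m + length.
index<⇒column≤ : ∀ m c k → m < c → c ∸ suc m < k → c ≤ m + k
index<⇒column≤ zero (suc c) k _ i<k = i<k
index<⇒column≤ (suc m) (suc c) k m<c i<k = s≤s (index<⇒column≤ m c k (s≤s⁻¹ m<c) i<k)

column≤⇒index< : ∀ m c k → m < c → c ≤ m + k → c ∸ suc m < k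
column≤⇒index< zero (suc c) k _ c≤k = c≤k
column≤⇒index< (suc m) (suc c) k m<c c≤m+k = column≤⇒index< m c k (s≤s⁻¹ m<c) (s≤s⁻¹ c≤m+k)

column>⇒index≥ : ∀ m k c → m + k < c → k ≤ c ∸ suc m
column>⇒index≥ zero k (suc c) m+k<c = s≤s⁻¹ m+k<c
column>⇒index≥ (suc m) k (suc c) m+k<c = column>⇒index≥ m k c (s≤s⁻¹ m+k<c)

ColumnStrict : ℕ → List (Fin n) → ℕ → List (Fin n) → Set
ColumnStrict m xs m′ ys = ∀ c x y → m < c → nth xs (c ∸ suc m) ≡ just x → m′ < c → nth ys (c ∸ suc m′) ≡ just y → x Fin.< y

-- The same condition expressed by counting: for each j the entries ≤ j+1
-- of the lower row end no further right than the entries ≤ j of the upper row.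
CountsBelow : ℕ → List (Fin n) → ℕ → List (Fin n) → Set
CountsBelow m xs m′ ys = ∀ j → countUpTo (suc j) ys + m′ ≤ m + countUpTo j xs

countsBelow-trans : ((m , xs) (m′ , ys) (m″ , zs) : ℕ × List (Fin n)) →
  CountsBelow m xs m′ ys → CountsBelow m′ ys m″ zs → CountsBelow m xs m″ zs
countsBelow-trans (m , xs) (m′ , ys) (m″ , zs) xs≥ys ys≥zs j =
  ≤-trans (ys≥zs j) (≤-trans (+-monoʳ-≤ m′ (m≤m+n (countUpTo j ys) _)) (≤-trans (≤-reflexive (+-comm m′ _)) (xs≥ys j)))

-- For sorted rows the counting condition implies column strictness: if y sits
-- in column c of the lower row, then c ≤ m′ + #(entries ≤ y of ys)
-- ≤ m + #(entries < y of xs), so the entry of xs in column c is < y.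
countsBelow⇒columnStrict : ∀ {m m′} (xs ys : List (Fin n)) → Sorted xs → Sorted ys →
  CountsBelow m xs m′ ys → ColumnStrict m xs m′ ys
countsBelow⇒columnStrict {m = m} {m′} xs ys sorted-xs sorted-ys below c x y m<c at-x m′<c at-y
  with val x ≤? toℕ y
... | yes x<y = x<y
... | no x≮y = contradiction (countUpTo≤index (toℕ y) xs _ x sorted-xs at-x (≰⇒> x≮y)) (<⇒≱ index-x<)
  where
  column≤ : c ≤ m + countUpTo (toℕ y) xs
  column≤ = ≤-trans (index<⇒column≤ m′ c _ m′<c (index<countUpTo (val y) ys _ y sorted-ys at-y ≤-refl))
                    (≤-trans (≤-reflexive (+-comm m′ _)) (below (toℕ y)))
  index-x< : c ∸ suc m < countUpTo (toℕ y) xs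
  index-x< = column≤⇒index< m c _ m<c column≤

columnStrict⇒countsBelow : ∀ {m m′} (xs ys : List (Fin n)) → Sorted xs → Sorted ys →
  m′ ≤ m → m′ + length ys ≤ m + length xs → ColumnStrict m xs m′ ys → CountsBelow m xs m′ ys
columnStrict⇒countsBelow {n} {m = m} {m′} xs ys sorted-xs sorted-ys m′≤m ends-before strict j
  with countUpTo (suc j) ys in counted
... | zero = ≤-trans m′≤m (m≤m+n m _)
... | suc p with m′ + suc p ≤? m + countUpTo j xs
...   | yes within = ≤-trans (≤-reflexive (+-comm (suc p) m′)) within
...   | no beyond = contradiction (≤-trans (strict c x y m<c at-x m′<c at-y) y≤j) (<⇒≱ j<x)
  where
  -- the last entry y ≤ j+1 of the lower row, in column c
  c : ℕ
  c = m′ + suc p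
  p<length : p < length ys
  p<length = ≤-trans (≤-reflexive (sym counted)) (countUpTo≤length (suc j) ys)
  y : Fin n
  y = proj₁ (nth-exists ys p p<length)
  at-p : nth ys p ≡ just y
  at-p = proj₂ (nth-exists ys p p<length)
  at-y : nth ys (c ∸ suc m′) ≡ just y
  at-y = subst (λ k → nth ys k ≡ just y) (sym (trans (cong (_∸ suc m′) (+-suc m′ p)) (m+n∸m≡n m′ p))) at-p
  y≤j : toℕ y ≤ j
  y≤j with val y ≤? suc j
  ... | yes y≤1+j = s≤s⁻¹ y≤1+j
  ... | no y≰1+j = contradiction (subst (_≤ p) counted (countUpTo≤index (suc j) ys p y sorted-ys at-p (≰⇒> y≰1+j))) (n≮n p)
  m′<c : m′ < c
  m′<c = m<m+n m′ (s≤s z≤n)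
  m<c : m < c
  m<c = ≤-<-trans (m≤m+n m _) (≰⇒> beyond)
  -- the entry x above y
  c-in-xs : c ∸ suc m < length xs
  c-in-xs = column≤⇒index< m c (length xs) m<c (≤-trans (+-monoʳ-≤ m′ p<length) ends-before)
  x : Fin n
  x = proj₁ (nth-exists xs (c ∸ suc m) c-in-xs)
  at-x : nth xs (c ∸ suc m) ≡ just x
  at-x = proj₂ (nth-exists xs (c ∸ suc m) c-in-xs)
  j<x : j < val x
  j<x with val x ≤? j
  ... | no x≰j = ≰⇒> x≰j
  ... | yes x≤j = contradiction (index<countUpTo j xs _ x sorted-xs at-x x≤j)
                                (≤⇒≯ (column>⇒index≥ m (countUpTo j xs) c (≰⇒> beyond)))

nth-toList : ∀ {A : Set} (v : Vec A n) (i : Fin n) → nth (toList v) (toℕ i) ≡ just (lookup v i)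
nth-toList (x Vec.∷ v) Fin.zero = refl
nth-toList (x Vec.∷ v) (Fin.suc i) = nth-toList v i

nth-beyond : ∀ {A : Set} (xs : List A) k → length xs ≤ k → nth xs k ≡ nothing
nth-beyond [] k _ = refl
nth-beyond (x ∷ xs) (suc k) len≤k = nth-beyond xs k (s≤s⁻¹ len≤k)

entry : Vec ℕ n → ℕ → ℕ
entry v k = fromMaybe 0 (nth (toList v) (k ∸ 1))

entry-lookup : (v : Vec ℕ n) (i : Fin n) → entry v (val i) ≡ lookup v i
entry-lookup v i = cong (fromMaybe 0) (nth-toList v i)

rowN-lookup : (Y : Tableau n) (i : Fin n) → rowN Y (val i) ≡ lookup Y i
rowN-lookup Y i = cong (fromMaybe []) (nth-toList Y i)

rowN-beyond : (Y : Tableau n) (k : ℕ) → n < k → rowN Y k ≡ []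
rowN-beyond Y (suc k) n<k =
  cong (fromMaybe []) (nth-beyond (toList Y) k (≤-trans (≤-reflexive (VecP.length-toList Y)) (s≤s⁻¹ n<k)))

at-index : ∀ {P : ℕ → Set} → (∀ (i : Fin n) → P (toℕ i)) → ∀ k → k < n → P k
at-index {P = P} h k k<n = subst P (FinP.toℕ-fromℕ< k<n) (h (fromℕ< k<n))

entry-toℤs : (v : Vec ℕ n) (k : ℕ) → toℤs v ‼ k ≡ + entry v k
entry-toℤs v k = go v (k ∸ 1)
  where
  go : ∀ {n} (v : Vec ℕ n) k → fromMaybe (+ 0) (nth (toList (toℤs v)) k) ≡ + fromMaybe 0 (nth (toList v) k)
  go Vec.[] k = refl
  go (x Vec.∷ v) zero = refl
  go (x Vec.∷ v) (suc k) = go v k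

entry-difference : (u v : Vec ℕ n) (k : ℕ) → entry (u -ʷ v) k ≡ entry u k ∸ entry v k
entry-difference u v k = go u v (k ∸ 1)
  where
  go : ∀ {n} (u v : Vec ℕ n) k → fromMaybe 0 (nth (toList (u -ʷ v)) k) ≡ fromMaybe 0 (nth (toList u) k) ∸ fromMaybe 0 (nth (toList v) k)
  go Vec.[] Vec.[] k = refl
  go (x Vec.∷ u) (y Vec.∷ v) zero = refl
  go (x Vec.∷ u) (y Vec.∷ v) (suc k) = go u v k

entry-fromℕ< : (v : Vec ℕ n) (k : ℕ) (k<n : k < n) → entry v (suc k) ≡ lookup v (fromℕ< k<n)
entry-fromℕ< v k k<n = trans (cong (λ j → entry v (suc j)) (sym (FinP.toℕ-fromℕ< k<n))) (entry-lookup v (fromℕ< k<n))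

rowN-fromℕ< : (Y : Tableau n) (k : ℕ) (k<n : k < n) → rowN Y (suc k) ≡ lookup Y (fromℕ< k<n)
rowN-fromℕ< Y k k<n = trans (cong (λ j → rowN Y (suc j)) (sym (FinP.toℕ-fromℕ< k<n))) (rowN-lookup Y (fromℕ< k<n))

dominant-step : (v : Vec ℕ n) → Dominant v → ∀ k → suc k < n → entry v (suc (suc k)) ≤ entry v (suc k)
dominant-step {n} v dom k 1+k<n =
  subst₂ _≤_ (sym (entry-fromℕ< v (suc k) 1+k<n)) (sym (entry-fromℕ< v k k<n))
    (dom (fromℕ< k<n) (fromℕ< 1+k<n) (subst₂ _≤_ (sym (FinP.toℕ-fromℕ< k<n)) (sym (FinP.toℕ-fromℕ< 1+k<n)) (n≤1+n k)))
  where
  k<n : k < n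
  k<n = <-trans (n<1+n k) 1+k<n

vec-ext : ∀ {A : Set} (xs ys : Vec A n) → (∀ i → lookup xs i ≡ lookup ys i) → xs ≡ ys
vec-ext xs ys same = trans (sym (VecP.tabulate∘lookup xs)) (trans (VecP.tabulate-cong same) (VecP.tabulate∘lookup ys))

sumZ-+ : ∀ m (f : ℕ → ℕ) → sumZ m (λ h → + f h) ≡ + sumN m f
sumZ-+ zero f = refl
sumZ-+ (suc m) f = trans (cong (ℤ._+ + f (suc m)) (sumZ-+ m f)) (sym (ℤP.pos-+ (sumN m f) (f (suc m))))

sumZ-cong : ∀ i (f g : ℕ → ℤ) → (∀ k → 1 ≤ k → k ≤ i → f k ≡ g k) → sumZ i f ≡ sumZ i g
sumZ-cong zero f g f≗g = refl
sumZ-cong (suc i) f g f≗g =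
  cong₂ ℤ._+_ (sumZ-cong i f g (λ k 1≤k k≤i → f≗g k 1≤k (m≤n⇒m≤1+n k≤i))) (f≗g (suc i) (s≤s z≤n) ≤-refl)

module _ where
  open +-*-Solver

  sumZ-difference : ∀ m (f g : ℕ → ℕ) → sumZ m (λ h → + f h ℤ.- + g h) ≡ + sumN m f ℤ.- + sumN m g
  sumZ-difference zero f g = refl
  sumZ-difference (suc m) f g
    rewrite sumZ-difference m f g | ℤP.pos-+ (sumN m f) (f (suc m)) | ℤP.pos-+ (sumN m g) (g (suc m)) =
    solve 4 (λ a b c d → (a :- b) :+ (c :- d) := (a :+ c) :- (b :+ d)) refl (+ sumN m f) (+ sumN m g) (+ f (suc m)) (+ g (suc m))

  +-difference : ∀ x y → + (x + y) ℤ.- + x ≡ + y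
  +-difference x y rewrite ℤP.pos-+ x y = solve 2 (λ a b → (a :+ b) :- a := b) refl (+ x) (+ y)

  add-difference : ∀ x y → x ℤ.+ (y ℤ.- x) ≡ y
  add-difference = solve 2 (λ x y → x :+ (y :- x) := y) refl

  second-difference : ∀ x u w → + (x + u + w) ℤ.- + 2 ℤ.* + (x + u) ℤ.+ + x ≡ + w ℤ.- + u
  second-difference x u w rewrite ℤP.pos-+ (x + u) w | ℤP.pos-+ x u =
    solve 3 (λ a b c → (a :+ b :+ c) :- con (+ 2) :* (a :+ b) :+ a := c :- b) refl (+ x) (+ u) (+ w)

  difference-≤⇒ : ∀ a b c d → + a ℤ.- + b ℤ.≤ + c ℤ.- + d → a + d ≤ c + b
  difference-≤⇒ a b c d a-b≤c-d = ℤP.drop‿+≤+ (subst₂ ℤ._≤_ left right (ℤP.+-monoˡ-≤ (+ b ℤ.+ + d) a-b≤c-d))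
    where
    left : + a ℤ.- + b ℤ.+ (+ b ℤ.+ + d) ≡ + (a + d)
    left rewrite ℤP.pos-+ a d = solve 3 (λ x y z → x :- y :+ (y :+ z) := x :+ z) refl (+ a) (+ b) (+ d)
    right : + c ℤ.- + d ℤ.+ (+ b ℤ.+ + d) ≡ + (c + b)
    right rewrite ℤP.pos-+ c b = solve 3 (λ x y z → x :- z :+ (y :+ z) := x :+ y) refl (+ c) (+ b) (+ d)

  ≤⇒difference-≤ : ∀ a b c d → a + d ≤ c + b → + a ℤ.- + b ℤ.≤ + c ℤ.- + d
  ≤⇒difference-≤ a b c d a+d≤c+b = subst₂ ℤ._≤_ left right (ℤP.+-monoˡ-≤ (ℤ.- (+ b) ℤ.- + d) (ℤ.+≤+ a+d≤c+b))
    where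
    left : + (a + d) ℤ.+ (ℤ.- (+ b) ℤ.- + d) ≡ + a ℤ.- + b
    left rewrite ℤP.pos-+ a d = solve 3 (λ x y z → (x :+ z) :+ (:- y :- z) := x :- y) refl (+ a) (+ b) (+ d)
    right : + (c + b) ℤ.+ (ℤ.- (+ b) ℤ.- + d) ≡ + c ℤ.- + d
    right rewrite ℤP.pos-+ c b = solve 3 (λ x y z → (x :+ y) :+ (:- y :- z) := x :- z) refl (+ c) (+ b) (+ d)

AgreeUpTo : ℕ → TArray → TArray → Set
AgreeUpTo n T T′ = ∀ i j → 1 ≤ j → j ≤ i → i ≤ n → T i j ≡ T′ i j

ε-cong : ∀ {n T T′} → AgreeUpTo n T T′ → ∀ i j → 1 ≤ j → j ≤ i → suc i ≤ n → ε T i j ≡ ε T′ i j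
ε-cong {n} {T} {T′} agree i (suc j) _ 1+j≤i 1+i≤n =
  cong₂ ℤ._+_ (sumZ-cong j _ _ secondDifferences)
              (cong₂ ℤ._-_ (agree (suc i) (suc j) (s≤s z≤n) (m≤n⇒m≤1+n 1+j≤i) 1+i≤n) (agree i (suc j) (s≤s z≤n) 1+j≤i i≤n))
  where
  i≤n : i ≤ n
  i≤n = ≤-trans (n≤1+n i) 1+i≤n
  j≤i-1 : j ≤ i ∸ 1
  j≤i-1 = ∸-monoˡ-≤ 1 1+j≤i
  secondDifferences : ∀ h → 1 ≤ h → h ≤ j →
    T (suc i) h ℤ.- + 2 ℤ.* T i h ℤ.+ T (i ∸ 1) h ≡ T′ (suc i) h ℤ.- + 2 ℤ.* T′ i h ℤ.+ T′ (i ∸ 1) h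
  secondDifferences h 1≤h h≤j =
    cong₂ ℤ._+_ (cong₂ ℤ._-_ (agree (suc i) h 1≤h (≤-trans h≤j (≤-trans (n≤1+n j) (m≤n⇒m≤1+n 1+j≤i))) 1+i≤n)
                             (cong (+ 2 ℤ.*_) (agree i h 1≤h (≤-trans h≤j (≤-trans (n≤1+n j) 1+j≤i)) i≤n)))
                (agree (i ∸ 1) h 1≤h (≤-trans h≤j j≤i-1) (≤-trans (m∸n≤m i 1) i≤n))

weight-cong : ∀ {n T T′} → AgreeUpTo n T T′ → ∀ i → i ≤ n → weightOf T i ≡ weightOf T′ i
weight-cong agree zero _ = refl
weight-cong agree (suc i) 1+i≤n =
  cong₂ ℤ._-_ (sumZ-cong (suc i) _ _ (λ k 1≤k k≤1+i → agree (suc i) k 1≤k k≤1+i 1+i≤n))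
              (sumZ-cong i _ _ (λ k 1≤k k≤i → agree i k 1≤k k≤i (≤-trans (n≤1+n i) 1+i≤n)))

module Counts {n : ℕ} (Y : Tableau n) where

  rowCount : ℕ → ℕ → ℕ
  rowCount k v = count v (rowN Y k)

  S : ℕ → ℕ → ℕ
  S i v = upperCount v i (toList Y)

  P : ℕ → ℕ → ℕ
  P k m = countUpTo m (rowN Y k)

  tArray : TArray
  tArray i j = + S i j

  companion-transpose : (i j : Fin n) → a (companion Y) (val i) (val j) ≡ a Y (val j) (val i)
  companion-transpose i j =
    trans (cong (count (val i)) (trans (rowN-lookup (companion Y) j) (VecP.lookup∘tabulate _ j)))
          (count-blocks (λ k → a Y (val j) (val k)) i)

  ψ-agrees : AgreeUpTo n (ψ Y) tArray
  ψ-agrees i (suc j) _ 1+j≤i i≤n = cong +_ (sumN-cong i _ _ transpose)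
    where
    j<n : j < n
    j<n = ≤-trans 1+j≤i i≤n
    transpose : ∀ k → 1 ≤ k → k ≤ i → a (companion Y) k (suc j) ≡ rowCount k (suc j)
    transpose (suc k) _ 1+k≤i =
      at-index {P = λ k → a (companion Y) (suc k) (suc j) ≡ a Y (suc j) (suc k)}
        (λ i′ → at-index {P = λ j → a (companion Y) (val i′) (suc j) ≡ a Y (suc j) (val i′)} (companion-transpose i′) j j<n)
        k (≤-trans 1+k≤i i≤n)

  ε-formula : ∀ i j → ε tArray (suc i) (suc j) ≡ + P (suc (suc i)) (suc j) ℤ.- + P (suc i) j
  ε-formula i j = begin
      sumZ j (λ h → tArray (2+ i) h ℤ.- + 2 ℤ.* tArray (suc i) h ℤ.+ tArray i h) ℤ.+ (tArray (2+ i) (suc j) ℤ.- tArray (suc i) (suc j))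
    ≡⟨ cong₂ ℤ._+_ (trans (sumZ-cong j _ _ (λ h _ _ → second-difference (S i h) (rowCount (suc i) h) (rowCount (2+ i) h)))
                          (sumZ-difference j _ _))
                   (+-difference (S (suc i) (suc j)) (rowCount (2+ i) (suc j))) ⟩
      (+ P (2+ i) j ℤ.- + P (suc i) j) ℤ.+ + rowCount (2+ i) (suc j)
    ≡⟨ solve 3 (λ x y z → (x :- y) :+ z := (x :+ z) :- y) refl (+ P (2+ i) j) (+ P (suc i) j) (+ rowCount (2+ i) (suc j)) ⟩
      (+ P (2+ i) j ℤ.+ + rowCount (2+ i) (suc j)) ℤ.- + P (suc i) j
    ≡⟨ cong (ℤ._- + P (suc i) j) (sym (ℤP.pos-+ (P (2+ i) j) _)) ⟩
      + P (2+ i) (suc j) ℤ.- + P (suc i) j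
    ∎
    where
    open ≡-Reasoning
    open +-*-Solver
    2+ : ℕ → ℕ
    2+ i = suc (suc i)

  -- Row k contains only entries ≤ k (true for LR tableaux by the Yamanouchi
  -- condition, and for the tableaux built from GZ patterns by construction).
  RowsBounded : Set
  RowsBounded = ∀ k v → 1 ≤ k → k < v → rowCount k v ≡ 0

  module Bounded (bounded : RowsBounded) where

    S-vanishes : ∀ i v → i < v → S i v ≡ 0
    S-vanishes i v i<v = sumN-zero i _ (λ k 1≤k k≤i → bounded k v 1≤k (≤-<-trans k≤i i<v))

    P-full : ∀ k m → 1 ≤ k → k ≤ n → k ≤ m → P k m ≡ length (rowN Y k)
    P-full k m 1≤k k≤n k≤m = trans (sumN-tail k m _ (λ v k<v → bounded k v 1≤k k<v) k≤m)
                                   (trans (sym (sumN-tail k n _ (λ v k<v → bounded k v 1≤k k<v) k≤n))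
                                          (countUpTo-length (rowN Y k)))

    weight-formula : ∀ i → suc i ≤ n → weightOf tArray (suc i) ≡ + length (rowN Y (suc i))
    weight-formula i 1+i≤n = begin
        sumZ (suc i) (λ h → + S (suc i) h) ℤ.- sumZ i (λ h → + S i h)
      ≡⟨ cong₂ ℤ._-_ (sumZ-+ (suc i) _) (sumZ-+ i _) ⟩
        + sumN (suc i) (λ h → S i h + rowCount (suc i) h) ℤ.- + sumN i (S i)
      ≡⟨ cong (λ s → + s ℤ.- + sumN i (S i)) (sumN-+ (suc i) (S i) (rowCount (suc i))) ⟩
        + (sumN i (S i) + S i (suc i) + P (suc i) (suc i)) ℤ.- + sumN i (S i)
      ≡⟨ cong (λ s → + (sumN i (S i) + s + P (suc i) (suc i)) ℤ.- + sumN i (S i)) (S-vanishes i (suc i) ≤-refl) ⟩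
        + (sumN i (S i) + 0 + P (suc i) (suc i)) ℤ.- + sumN i (S i)
      ≡⟨ cong (λ s → + (s + P (suc i) (suc i)) ℤ.- + sumN i (S i)) (+-identityʳ (sumN i (S i))) ⟩
        + (sumN i (S i) + P (suc i) (suc i)) ℤ.- + sumN i (S i)
      ≡⟨ +-difference (sumN i (S i)) _ ⟩
        + P (suc i) (suc i)
      ≡⟨ cong +_ (P-full (suc i) (suc i) (s≤s z≤n) 1+i≤n ≤-refl) ⟩
        + length (rowN Y (suc i))
      ∎
      where open ≡-Reasoning

  ε-bound⇒counts : ∀ i j m m′ → ε tArray (suc i) (suc j) ℤ.≤ + m ℤ.- + m′ → P (suc (suc i)) (suc j) + m′ ≤ m + P (suc i) j
  ε-bound⇒counts i j m m′ bound = difference-≤⇒ _ _ m m′ (subst (ℤ._≤ + m ℤ.- + m′) (ε-formula i j) bound)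

  counts⇒ε-bound : ∀ i j m m′ → P (suc (suc i)) (suc j) + m′ ≤ m + P (suc i) j → ε tArray (suc i) (suc j) ℤ.≤ + m ℤ.- + m′
  counts⇒ε-bound i j m m′ below = subst (ℤ._≤ + m ℤ.- + m′) (sym (ε-formula i j)) (≤⇒difference-≤ _ _ m m′ below)

below-last : ∀ {n} i → 1 ≤ i → i ≤ n ∸ 1 → suc i ≤ n
below-last {suc n} i _ i≤n-1 = s≤s i≤n-1
below-last {zero} (suc i) _ ()

below-last⁻ : ∀ {n} i → suc i ≤ n → i ≤ n ∸ 1
below-last⁻ {suc n} i (s≤s i≤n-1) = i≤n-1

module FromLR {n : ℕ} (la mu nu : Vec ℕ n) (Y : Tableau n) (lr : IsLR la mu nu Y) where
  open Counts Y
  open IsLR lr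

  row-sorted : ∀ k → k < n → Sorted (rowN Y (suc k))
  row-sorted = at-index {P = λ k → Sorted (rowN Y (suc k))} (λ i → subst Sorted (sym (rowN-lookup Y i)) (rowWeak i))

  row-length : ∀ k → k < n → entry mu (suc k) + length (rowN Y (suc k)) ≡ entry la (suc k)
  row-length = at-index {P = λ k → entry mu (suc k) + length (rowN Y (suc k)) ≡ entry la (suc k)}
    (λ i → subst₂ (λ m r → m + length r ≡ entry la (val i)) (sym (entry-lookup mu i)) (sym (rowN-lookup Y i))
                  (trans (shape i) (sym (entry-lookup la i))))

  content-S : ∀ j → j < n → S n (suc j) ≡ entry nu (suc j)
  content-S j j<n = begin
      S n (suc j)                                    ≡⟨ cong (λ l → upperCount (suc j) l (toList Y)) (sym (VecP.length-toList Y)) ⟩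
      upperCount (suc j) (length (toList Y)) (toList Y) ≡⟨ sym (concat-count (suc j) (toList Y)) ⟩
      count (suc j) (concat (toList Y))              ≡⟨ at-index {P = λ j → count (suc j) (concat (toList Y)) ≡ entry nu (suc j)}
                                                                 (λ i → trans (content i) (sym (entry-lookup nu i))) j j<n ⟩
      entry nu (suc j)                               ∎
    where open ≡-Reasoning

  -- the Yamanouchi condition, row by row
  S-step : ∀ i v → suc i ≤ n → 1 ≤ v → S (suc i) (suc v) ≤ S i v
  S-step i v i<n 1≤v =
    yamanouchi⇒upper-inequality v (toList Y) i (subst (i <_) (sym (VecP.length-toList Y)) i<n) (row-sorted i i<n) reverseYamanouchi
    where
    reverseYamanouchi : YamanouchiFor v (reverseWord (toList Y))
    reverseYamanouchi k = subst (λ w → count (suc v) (take k w) ≤ count v (take k w))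
                                (reverse-readingWord (toList Y)) (yamanouchi k v 1≤v)

  S-vanishes : ∀ i v → i ≤ n → i < v → S i v ≡ 0
  S-vanishes zero v _ _ = refl
  S-vanishes (suc i) (suc v) 1+i≤n 1+i≤v =
    n≤0⇒n≡0 (≤-trans (S-step i v 1+i≤n (≤-trans (s≤s z≤n) (s≤s⁻¹ 1+i≤v)))
                     (≤-reflexive (S-vanishes i v (≤-trans (n≤1+n i) 1+i≤n) (s≤s⁻¹ 1+i≤v))))

  rows-bounded : RowsBounded
  rows-bounded (suc k) v _ k<v with suc k ≤? n
  ... | yes 1+k≤n = n≤0⇒n≡0 (≤-trans (m≤n+m _ (S k v)) (≤-reflexive (S-vanishes (suc k) v 1+k≤n k<v)))
  ... | no 1+k≰n = cong (count v) (rowN-beyond Y (suc k) (≰⇒> 1+k≰n))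

  open Bounded rows-bounded

  -- column strictness between consecutive rows, as counts; the dominance of
  -- λ and μ makes each row start and end no further right than the one above.
  adjacent-counts : Dominant la → Dominant mu → ∀ i → suc (suc i) ≤ n →
    CountsBelow (entry mu (suc i)) (rowN Y (suc i)) (entry mu (suc (suc i))) (rowN Y (suc (suc i)))
  adjacent-counts dom-la dom-mu i 2+i≤n =
    columnStrict⇒countsBelow (rowN Y (suc i)) (rowN Y (suc (suc i))) (row-sorted i 1+i≤n) (row-sorted (suc i) 2+i≤n)
      (dominant-step mu dom-mu i 2+i≤n) ends-before strict
    where
    1+i≤n : suc i ≤ n
    1+i≤n = ≤-trans (n≤1+n (suc i)) 2+i≤n
    ends-before : entry mu (suc (suc i)) + length (rowN Y (suc (suc i))) ≤ entry mu (suc i) + length (rowN Y (suc i))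
    ends-before = subst₂ _≤_ (sym (row-length (suc i) 2+i≤n)) (sym (row-length i 1+i≤n)) (dominant-step la dom-la i 2+i≤n)
    strict : ColumnStrict (entry mu (suc i)) (rowN Y (suc i)) (entry mu (suc (suc i))) (rowN Y (suc (suc i)))
    strict c x y
      rewrite entry-fromℕ< mu i 1+i≤n | rowN-fromℕ< Y i 1+i≤n | entry-fromℕ< mu (suc i) 2+i≤n | rowN-fromℕ< Y (suc i) 2+i≤n =
      colStrict (fromℕ< 1+i≤n) (fromℕ< 2+i≤n) c x y
        (subst₂ _<_ (sym (FinP.toℕ-fromℕ< 1+i≤n)) (sym (FinP.toℕ-fromℕ< 2+i≤n)) ≤-refl)

  isGZ : Dominant la → Dominant mu → IsGZ (toℤs nu) (toℤs (la -ʷ mu)) (toℤs mu) (ψ Y)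
  isGZ dom-la dom-mu = record
    { gt = record
      { type = λ { (suc j) _ j<n → trans (ψ-agrees n (suc j) (s≤s z≤n) j<n ≤-refl)
                                   (trans (cong +_ (content-S j j<n)) (sym (entry-toℤs nu (suc j)))) }
      ; weight = λ { (suc i) _ i<n → trans (weight-cong ψ-agrees (suc i) i<n)
                                     (trans (weight-formula i i<n) (trans (cong +_ (length≡ i i<n)) (sym (entry-toℤs (la -ʷ mu) (suc i))))) }
      ; interlace₁ = λ i j 1≤j j≤i i≤n-1 → let 1+i≤n = below-last i (≤-trans 1≤j j≤i) i≤n-1 in
          subst₂ ℤ._≤_ (sym (ψ-agrees i j 1≤j j≤i (≤-trans (n≤1+n i) 1+i≤n))) (sym (ψ-agrees (suc i) j 1≤j (m≤n⇒m≤1+n j≤i) 1+i≤n))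
            (ℤ.+≤+ (m≤m+n (S i j) _))
      ; interlace₂ = λ { i (suc j) 1≤j j≤i i≤n-1 → let 1+i≤n = below-last i (≤-trans 1≤j j≤i) i≤n-1 in
          subst₂ ℤ._≤_ (sym (ψ-agrees (suc i) (suc (suc j)) (s≤s z≤n) (s≤s j≤i) 1+i≤n)) (sym (ψ-agrees i (suc j) 1≤j j≤i (≤-trans (n≤1+n i) 1+i≤n)))
            (ℤ.+≤+ (S-step i (suc j) 1+i≤n (s≤s z≤n))) }
      }
    ; expBound = λ { (suc i) (suc j) 1≤j j≤i i≤n-1 → let 2+i≤n = below-last (suc i) (s≤s z≤n) i≤n-1 in
        subst₂ ℤ._≤_ (sym (ε-cong ψ-agrees (suc i) (suc j) 1≤j j≤i 2+i≤n))
                     (sym (cong₂ ℤ._-_ (entry-toℤs mu (suc i)) (entry-toℤs mu (suc (suc i)))))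
          (counts⇒ε-bound i j _ _ (adjacent-counts dom-la dom-mu i 2+i≤n j)) }
    }
    where
    length≡ : ∀ i → suc i ≤ n → length (rowN Y (suc i)) ≡ entry (la -ʷ mu) (suc i)
    length≡ i i<n = trans (sym (m+n∸m≡n (entry mu (suc i)) _)) (trans (cong (_∸ entry mu (suc i)) (row-length i i<n)) (sym (entry-difference la mu (suc i))))

-- ψ is injective on LR tableaux: ψ(Y) determines the numbers S i v, hence
-- the multiplicities of each row, hence each (sorted) row.
module Injective {n : ℕ} (la mu nu : Vec ℕ n) (Y Y′ : Tableau n)
                 (lr : IsLR la mu nu Y) (lr′ : IsLR la mu nu Y′) (same : ψ Y ≈[ n ] ψ Y′) where
  module C = Counts Y
  module C′ = Counts Y′
  module L = FromLR la mu nu Y lr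
  module L′ = FromLR la mu nu Y′ lr′

  S-agree : ∀ i v → i ≤ n → C.S i v ≡ C′.S i v
  S-agree i zero _ = trans (sumN-zero i _ (λ k _ _ → count-zero (rowN Y k))) (sym (sumN-zero i _ (λ k _ _ → count-zero (rowN Y′ k))))
  S-agree i (suc v) i≤n with i ≤? v
  ... | yes i≤v = trans (L.S-vanishes i (suc v) i≤n (s≤s i≤v)) (sym (L′.S-vanishes i (suc v) i≤n (s≤s i≤v)))
  ... | no i≰v = ℤP.+-injective (trans (sym (C.ψ-agrees i (suc v) (s≤s z≤n) v<i i≤n))
                                       (trans (same i (suc v) (s≤s z≤n) v<i i≤n) (C′.ψ-agrees i (suc v) (s≤s z≤n) v<i i≤n)))
    where
    v<i : v < i
    v<i = ≰⇒> i≰v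

  rowCount-agree : ∀ k v → suc k ≤ n → C.rowCount (suc k) v ≡ C′.rowCount (suc k) v
  rowCount-agree k v 1+k≤n = +-cancelˡ-≡ (C.S k v) _ _
    (trans (S-agree (suc k) v 1+k≤n) (cong (_+ C′.rowCount (suc k) v) (sym (S-agree k v (≤-trans (n≤1+n k) 1+k≤n)))))

  tableaux-equal : Y ≡ Y′
  tableaux-equal = vec-ext Y Y′ λ r →
    sorted-unique (lookup Y r) (lookup Y′ r) (IsLR.rowWeak lr r) (IsLR.rowWeak lr′ r)
      (λ v → subst₂ (λ u w → count v u ≡ count v w) (rowN-lookup Y r) (rowN-lookup Y′ r) (rowCount-agree (toℕ r) v (FinP.toℕ<n r)))

-- Every GZ pattern T is ψ of an LR tableau: row k consists of
-- t^{(k)}_v − t^{(k−1)}_v entries v for v < k and t^{(k)}_k entries k.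
module FromGZ {n : ℕ} (la mu nu : Vec ℕ n) (dom-la : Dominant la) (mu≤la : (i : Fin n) → lookup mu i ≤ lookup la i)
              (T : TArray) (gz : IsGZ (toℤs nu) (toℤs (la -ʷ mu)) (toℤs mu) T) where
  open IsGZ gz
  open IsGT gt

  -- t^{(i)}_j ≥ t^{(i+1)}_{j+1} ≥ … ≥ t^{(n)}_{j+n−i} = ν_{j+n−i} ≥ 0
  nonnegative : ∀ i j → 1 ≤ j → j ≤ i → i ≤ n → + 0 ℤ.≤ T i j
  nonnegative i j 1≤j j≤i i≤n = descend (n ∸ i) i j (m+[n∸m]≡n i≤n) 1≤j j≤i
    where
    descend : ∀ d i j → i + d ≡ n → 1 ≤ j → j ≤ i → + 0 ℤ.≤ T i j
    descend zero i j i+0≡n 1≤j j≤i = subst (λ t → + 0 ℤ.≤ t) (sym (trans (cong (λ m → T m j) i≡n) (trans (type j 1≤j (subst (j ≤_) i≡n j≤i)) (entry-toℤs nu j)))) (ℤ.+≤+ z≤n)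
      where
      i≡n : i ≡ n
      i≡n = trans (sym (+-identityʳ i)) i+0≡n
    descend (suc d) i j i+1+d≡n 1≤j j≤i =
      ℤP.≤-trans (descend d (suc i) (suc j) (trans (sym (+-suc i d)) i+1+d≡n) (s≤s z≤n) (s≤s j≤i))
                 (interlace₂ i j 1≤j j≤i (below-last⁻ i (≤-trans (s≤s (m≤m+n i d)) (≤-reflexive (trans (sym (+-suc i d)) i+1+d≡n)))))

  multiplicity : ℕ → ℕ → ℕ
  multiplicity k zero = 0
  multiplicity k (suc v) with <-cmp (suc v) k
  ... | tri< _ _ _ = ℤ.∣ T k (suc v) ℤ.- T (k ∸ 1) (suc v) ∣
  ... | tri≈ _ _ _ = ℤ.∣ T k (suc v) ∣
  ... | tri> _ _ _ = 0

  multiplicity-vanishes : ∀ k v → k < v → multiplicity k v ≡ 0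
  multiplicity-vanishes k (suc v) k<v with <-cmp (suc v) k
  ... | tri< v<k _ _ = contradiction k<v (<-asym v<k)
  ... | tri≈ _ v≡k _ = contradiction k<v (<-irrefl (sym v≡k))
  ... | tri> _ _ _ = refl

  Y : Tableau n
  Y = Vec.tabulate (λ r → blocks (λ x → multiplicity (val r) (val x)))

  open Counts Y

  row-Y : ∀ k → k < n → rowN Y (suc k) ≡ blocks (λ x → multiplicity (suc k) (val x))
  row-Y = at-index {P = λ k → rowN Y (suc k) ≡ blocks (λ x → multiplicity (suc k) (val x))}
                   (λ r → trans (rowN-lookup Y r) (VecP.lookup∘tabulate _ r))

  rowCount-multiplicity : ∀ k v → k < n → rowCount (suc k) v ≡ multiplicity (suc k) v
  rowCount-multiplicity k v k<n rewrite row-Y k k<n = counted v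
    where
    m : Fin n → ℕ
    m x = multiplicity (suc k) (val x)
    counted : ∀ v → count v (blocks m) ≡ multiplicity (suc k) v
    counted zero = count-zero (blocks m)
    counted (suc v) with v <? n
    ... | yes v<n = at-index {P = λ v → count (suc v) (blocks m) ≡ multiplicity (suc k) (suc v)} (count-blocks m) v v<n
    ... | no v≮n = trans (count-beyond (suc v) (blocks m) (s≤s (≮⇒≥ v≮n)))
                         (sym (multiplicity-vanishes (suc k) (suc v) (s≤s (<-≤-trans k<n (≮⇒≥ v≮n)))))

  rows-bounded : RowsBounded
  rows-bounded (suc k) v _ k<v with suc k ≤? n
  ... | yes 1+k≤n = trans (rowCount-multiplicity k v 1+k≤n) (multiplicity-vanishes (suc k) v k<v)
  ... | no 1+k≰n = cong (count v) (rowN-beyond Y (suc k) (≰⇒> 1+k≰n))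

  open Bounded rows-bounded

  S-agrees : AgreeUpTo n tArray T
  S-agrees (suc a) (suc b) _ 1+b≤1+a 1+a≤n rewrite rowCount-multiplicity a (suc b) 1+a≤n with <-cmp (suc b) (suc a)
  ... | tri< 1+b<1+a _ _ = begin
      + (S a (suc b) + ℤ.∣ T (suc a) (suc b) ℤ.- T a (suc b) ∣)
    ≡⟨ ℤP.pos-+ (S a (suc b)) _ ⟩
      + S a (suc b) ℤ.+ + ℤ.∣ T (suc a) (suc b) ℤ.- T a (suc b) ∣
    ≡⟨ cong₂ ℤ._+_ (S-agrees a (suc b) (s≤s z≤n) (s≤s⁻¹ 1+b<1+a) a≤n)
                   (ℤP.0≤i⇒+∣i∣≡i (ℤP.i≤j⇒0≤j-i (interlace₁ a (suc b) (s≤s z≤n) (s≤s⁻¹ 1+b<1+a) (below-last⁻ a 1+a≤n)))) ⟩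
      T a (suc b) ℤ.+ (T (suc a) (suc b) ℤ.- T a (suc b))
    ≡⟨ add-difference (T a (suc b)) _ ⟩
      T (suc a) (suc b)
    ∎
    where
    open ≡-Reasoning
    a≤n : a ≤ n
    a≤n = ≤-trans (n≤1+n a) 1+a≤n
  ... | tri≈ _ refl _ = trans (cong (λ s → + (s + ℤ.∣ T (suc a) (suc a) ∣)) (S-vanishes a (suc a) ≤-refl))
                              (ℤP.0≤i⇒+∣i∣≡i (nonnegative (suc a) (suc a) (s≤s z≤n) ≤-refl 1+a≤n))
  ... | tri> _ _ 1+a<1+b = contradiction 1+b≤1+a (<⇒≱ 1+a<1+b)

  row-length : ∀ k → k < n → entry mu (suc k) + length (rowN Y (suc k)) ≡ entry la (suc k)
  row-length k k<n = trans (cong (λ l → entry mu (suc k) + l) length≡) (m+[n∸m]≡n mu≤la′)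
    where
    mu≤la′ : entry mu (suc k) ≤ entry la (suc k)
    mu≤la′ = at-index {P = λ k → entry mu (suc k) ≤ entry la (suc k)}
               (λ i → subst₂ _≤_ (sym (entry-lookup mu i)) (sym (entry-lookup la i)) (mu≤la i)) k k<n
    length≡ : length (rowN Y (suc k)) ≡ entry la (suc k) ∸ entry mu (suc k)
    length≡ = ℤP.+-injective (begin
        + length (rowN Y (suc k))        ≡⟨ sym (weight-formula k k<n) ⟩
        weightOf tArray (suc k)          ≡⟨ weight-cong S-agrees (suc k) k<n ⟩
        weightOf T (suc k)               ≡⟨ weight (suc k) (s≤s z≤n) k<n ⟩
        toℤs (la -ʷ mu) ‼ suc k          ≡⟨ entry-toℤs (la -ʷ mu) (suc k) ⟩
        + entry (la -ʷ mu) (suc k)       ≡⟨ cong +_ (entry-difference la mu (suc k)) ⟩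
        + (entry la (suc k) ∸ entry mu (suc k)) ∎)
      where open ≡-Reasoning

  -- Consecutive rows satisfy the counting condition: for j ≤ i it is the
  -- exponent bound, for larger j it says that row i+2 ends below row i+1.
  adjacent-counts : ∀ i → suc (suc i) ≤ n →
    CountsBelow (entry mu (suc i)) (rowN Y (suc i)) (entry mu (suc (suc i))) (rowN Y (suc (suc i)))
  adjacent-counts i 2+i≤n j with suc j ≤? suc i
  ... | yes 1+j≤1+i = ε-bound⇒counts i j _ _
          (subst₂ ℤ._≤_ (ε-cong (λ a b p q r → sym (S-agrees a b p q r)) (suc i) (suc j) (s≤s z≤n) 1+j≤1+i 2+i≤n)
                        (cong₂ ℤ._-_ (entry-toℤs mu (suc i)) (entry-toℤs mu (suc (suc i))))
                        (expBound (suc i) (suc j) (s≤s z≤n) 1+j≤1+i (below-last⁻ (suc i) 2+i≤n)))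
  ... | no 1+j≰1+i = begin
      P (suc (suc i)) (suc j) + entry mu (suc (suc i))      ≡⟨ cong (_+ entry mu (suc (suc i))) (P-full (suc (suc i)) (suc j) (s≤s z≤n) 2+i≤n (≰⇒> 1+j≰1+i)) ⟩
      length (rowN Y (suc (suc i))) + entry mu (suc (suc i)) ≡⟨ +-comm _ (entry mu (suc (suc i))) ⟩
      entry mu (suc (suc i)) + length (rowN Y (suc (suc i))) ≡⟨ row-length (suc i) 2+i≤n ⟩
      entry la (suc (suc i))                                 ≤⟨ dominant-step la dom-la i 2+i≤n ⟩
      entry la (suc i)                                       ≡⟨ sym (row-length i 1+i≤n) ⟩
      entry mu (suc i) + length (rowN Y (suc i))             ≡⟨ cong (λ l → entry mu (suc i) + l) (sym (P-full (suc i) j (s≤s z≤n) 1+i≤n (s≤s⁻¹ (≰⇒> 1+j≰1+i)))) ⟩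
      entry mu (suc i) + P (suc i) j                         ∎
    where
    open ≤-Reasoning
    1+i≤n : suc i ≤ n
    1+i≤n = ≤-trans (n≤1+n (suc i)) 2+i≤n

  -- and hence, by transitivity, any two rows do.
  counts-below : ∀ k k′ → k < k′ → suc k′ ≤ n →
    CountsBelow (entry mu (suc k)) (rowN Y (suc k)) (entry mu (suc k′)) (rowN Y (suc k′))
  counts-below k (suc k′) k<1+k′ 2+k′≤n with m<1+n⇒m<n∨m≡n k<1+k′
  ... | inj₂ refl = adjacent-counts k 2+k′≤n
  ... | inj₁ k<k′ = countsBelow-trans (row k) (row k′) (row (suc k′))
                      (counts-below k k′ k<k′ (≤-trans (n≤1+n (suc k′)) 2+k′≤n)) (adjacent-counts k′ 2+k′≤n)
    where
    row : ℕ → ℕ × List (Fin n)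
    row i = entry mu (suc i) , rowN Y (suc i)

  -- the Yamanouchi condition, row by row, from the interlacing t^{(i+1)}_{v+1} ≤ t^{(i)}_v
  S-step : ∀ i v → suc i ≤ n → 1 ≤ v → S (suc i) (suc v) ≤ S i v
  S-step i v 1+i≤n 1≤v with v ≤? i
  ... | no v≰i = ≤-trans (≤-reflexive (S-vanishes (suc i) (suc v) (s≤s (≰⇒> v≰i)))) z≤n
  ... | yes v≤i = ℤP.drop‿+≤+ (subst₂ ℤ._≤_ (sym (S-agrees (suc i) (suc v) (s≤s z≤n) (s≤s v≤i) 1+i≤n))
                                            (sym (S-agrees i v 1≤v v≤i (≤-trans (n≤1+n i) 1+i≤n)))
                                            (interlace₂ i v 1≤v v≤i (below-last⁻ i 1+i≤n)))

  row-Y-lookup : (r : Fin n) → lookup Y r ≡ blocks (λ x → multiplicity (val r) (val x))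
  row-Y-lookup r = VecP.lookup∘tabulate _ r

  isLR : IsLR la mu nu Y
  isLR = record
    { shape = λ r → subst₂ (λ m row → m + length row ≡ lookup la r) (entry-lookup mu r) (rowN-lookup Y r)
                      (trans (row-length (toℕ r) (FinP.toℕ<n r)) (entry-lookup la r))
    ; rowWeak = λ r → subst Sorted (sym (row-Y-lookup r)) (blocks-sorted _)
    ; colStrict = λ r r′ c x y r<r′ → subst₂ (λ (m , xs) (m′ , ys) → ColumnStrict m xs m′ ys)
        (cong₂ _,_ (entry-lookup mu r) (rowN-lookup Y r)) (cong₂ _,_ (entry-lookup mu r′) (rowN-lookup Y r′))
        (countsBelow⇒columnStrict (rowN Y (val r)) (rowN Y (val r′)) (sorted r) (sorted r′)
          (counts-below (toℕ r) (toℕ r′) r<r′ (FinP.toℕ<n r′))) c x y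
    ; yamanouchi = λ k v 1≤v → subst (λ w → count (suc v) (take k w) ≤ count v (take k w))
        (sym (reverse-readingWord (toList Y)))
        (upper-inequality⇒yamanouchi v (toList Y)
          (λ i i<len → S-step i v (subst (i <_) (VecP.length-toList Y) i<len) 1≤v) k)
    ; content = λ k → ℤP.+-injective (begin
        + count (val k) (concat (toList Y))                ≡⟨ cong +_ (concat-count (val k) (toList Y)) ⟩
        + upperCount (val k) (length (toList Y)) (toList Y) ≡⟨ cong (λ l → + upperCount (val k) l (toList Y)) (VecP.length-toList Y) ⟩
        tArray n (val k)                                   ≡⟨ S-agrees n (val k) (s≤s z≤n) (FinP.toℕ<n k) ≤-refl ⟩
        T n (val k)                                        ≡⟨ type (val k) (s≤s z≤n) (FinP.toℕ<n k) ⟩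
        toℤs nu ‼ val k                                    ≡⟨ entry-toℤs nu (val k) ⟩
        + entry nu (val k)                                 ≡⟨ cong +_ (entry-lookup nu k) ⟩
        + lookup nu k                                      ∎)
    }
    where
    open ≡-Reasoning
    sorted : (r : Fin n) → Sorted (rowN Y (val r))
    sorted r = subst Sorted (sym (trans (rowN-lookup Y r) (row-Y-lookup r))) (blocks-sorted _)

  ψ-reproduces : ψ Y ≈[ n ] T
  ψ-reproduces i j 1≤j j≤i i≤n = trans (ψ-agrees i j 1≤j j≤i i≤n) (S-agrees i j 1≤j j≤i i≤n)

theorem5p3 : (n : ℕ) (la mu nu : Vec ℕ n) →
    Dominant la → Dominant mu → Dominant nu →
    ((i : Fin n) → lookup mu i ≤ lookup la i) →
    ((Y : Tableau n) → IsLR la mu nu Y →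
        IsGZ (toℤs nu) (toℤs (la -ʷ mu)) (toℤs mu) (ψ Y))
    × ((Y Y' : Tableau n) → IsLR la mu nu Y → IsLR la mu nu Y' →
        ψ Y ≈[ n ] ψ Y' → Y ≡ Y')
    × ((T : TArray) → IsGZ (toℤs nu) (toℤs (la -ʷ mu)) (toℤs mu) T →
        Σ (Tableau n) (λ Y → IsLR la mu nu Y × ψ Y ≈[ n ] T))
theorem5p3 n la mu nu dom-la dom-mu _ mu≤la = toGZ , injective , surjective
  where
  toGZ : (Y : Tableau n) → IsLR la mu nu Y → IsGZ (toℤs nu) (toℤs (la -ʷ mu)) (toℤs mu) (ψ Y)
  toGZ Y lr = FromLR.isGZ la mu nu Y lr dom-la dom-mu
  injective : (Y Y′ : Tableau n) → IsLR la mu nu Y → IsLR la mu nu Y′ → ψ Y ≈[ n ] ψ Y′ → Y ≡ Y′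
  injective Y Y′ lr lr′ same = Injective.tableaux-equal la mu nu Y Y′ lr lr′ same
  surjective : (T : TArray) → IsGZ (toℤs nu) (toℤs (la -ʷ mu)) (toℤs mu) T →
               Σ (Tableau n) (λ Y → IsLR la mu nu Y × ψ Y ≈[ n ] T)
  surjective T gz = preimage.Y , preimage.isLR , preimage.ψ-reproduces
    where module preimage = FromGZ la mu nu dom-la mu≤la T gz
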